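{- Let $G=(V,E)$ be a finite multigraph with edge weights $\boldsymbol\beta=(\beta_e)$ and all vertex weights equal to $\gamma$. Then $$\Theta_G(\boldsymbol\beta,\gamma)=\sum_{s\subset E}\ \prod_{n\ge0}\theta_{B_n}(1,\gamma)^{i_n(s)}\prod_{e\in s}\beta_e\prod_{e\in E\setminus s}(1-\beta_e),$$ where $i_n(s)$ is the number of connected components of the spanning subgraph $(V,s)$ with nullity $n$.
   Context: Loops contribute $2$ to degrees. $f_0=1,f_1=0,f_{n+1}(x)=xf_n(x)+f_{n-1}(x)$. $\Theta_G(\boldsymbol\beta,\boldsymbol\gamma)=\sum_{s\subset E}\prod_{e\in s}\beta_e\prod_{i\in V}f_{d_i(s)}(\gamma_i)$, $d_i(s)$ the degree of $i$ in $(V,s)$; $\Theta_G(\boldsymbol\beta,\gamma)$ denotes the case $\gamma_i=\gamma$ for all $i$, and $\theta_G(\beta,\gamma)$ the case where moreover all $\beta_e=\beta$. $B_n$ is the bouquet graph (one vertex, $n$ loops); thus $\theta_{B_n}(1,\gamma)=\sum_{k=0}^n\binom nk f_{2k}(\gamma)$. The nullity of a connected graph is $|E|-|V|+1$. -}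

module Defs where

open import Level using (Level)
open import Data.Nat as ℕ using (ℕ; zero; suc; _∸_; _<ᵇ_; _≡ᵇ_)
open import Data.Fin as Fin using (Fin; toℕ)
open import Data.Fin.Subset using (Subset; Side; inside; outside)
open import Data.Vec using (Vec; []; _∷_; lookup)
open import Data.Bool using (Bool; true; false; _∧_; _∨_; not; if_then_else_)
open import Data.Product using (_×_; _,_; proj₁; proj₂)
open import Relation.Nullary.Decidable using (⌊_⌋)
open import Algebra.Bundles using (CommutativeRing)

-- Finite multigraphs (loops and parallel edges allowed).
-- Vertices are Fin nV, edges are Fin nE; each edge has an (unordered)
-- pair of endpoints; a loop is an edge whose two endpoints coincide.

record Multigraph : Set where
  field
    nV   : ℕ
    nE   : ℕ
    ends : Fin nE → Fin nV × Fin nV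

open Multigraph public

bouquet : ℕ → Multigraph
bouquet n = record { nV = 1 ; nE = n ; ends = λ _ → (Fin.zero , Fin.zero) }

_==_ : ∀ {n} → Fin n → Fin n → Bool
a == b = ⌊ a Fin.≟ b ⌋

b2n : Bool → ℕ
b2n true  = 1
b2n false = 0

sumℕ : (k : ℕ) → (Fin k → ℕ) → ℕ
sumℕ zero    g = 0
sumℕ (suc k) g = g Fin.zero ℕ.+ sumℕ k (λ i → g (Fin.suc i))

count : (k : ℕ) → (Fin k → Bool) → ℕ
count k p = sumℕ k (λ i → b2n (p i))

anyFin : (k : ℕ) → (Fin k → Bool) → Bool
anyFin zero    p = false
anyFin (suc k) p = p Fin.zero ∨ anyFin k (λ i → p (Fin.suc i))

_∈ᵇ_ : ∀ {m} → Fin m → Subset m → Bool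
e ∈ᵇ s = lookup s e

-- Degree of vertex i in the spanning subgraph (V, s); loops contribute 2.

degree : (G : Multigraph) → Subset (nE G) → Fin (nV G) → ℕ
degree G s i =
  sumℕ (nE G) (λ e → if e ∈ᵇ s
                       then b2n (proj₁ (ends G e) == i) ℕ.+ b2n (proj₂ (ends G e) == i)
                       else 0)

-- Connected components of the spanning subgraph (V, s).
-- reach k v = set of vertices joined to v by a path (in s) of length ≤ k.

step : (G : Multigraph) → Subset (nE G) → (Fin (nV G) → Bool) → Fin (nV G) → Bool
step G s R w = R w ∨ anyFin (nE G) (λ e →
  (e ∈ᵇ s) ∧ ((R (proj₁ (ends G e)) ∧ (proj₂ (ends G e) == w))
           ∨ (R (proj₂ (ends G e)) ∧ (proj₁ (ends G e) == w))))

reach : (G : Multigraph) → Subset (nE G) → ℕ → Fin (nV G) → Fin (nV G) → Bool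
reach G s zero    v = λ w → v == w
reach G s (suc k) v = step G s (reach G s k v)

-- the vertex set of the connected component of v in (V, s)
-- (paths of length ≤ |V| suffice)
component : (G : Multigraph) → Subset (nE G) → Fin (nV G) → Fin (nV G) → Bool
component G s v = reach G s (nV G) v

isRep : (G : Multigraph) → Subset (nE G) → Fin (nV G) → Bool
isRep G s v = not (anyFin (nV G) (λ u → (toℕ u <ᵇ toℕ v) ∧ component G s v u))

nullity : (G : Multigraph) → Subset (nE G) → Fin (nV G) → ℕ
nullity G s v =
  (count (nE G) (λ e → (e ∈ᵇ s) ∧ component G s v (proj₁ (ends G e))
                                 ∧ component G s v (proj₂ (ends G e)))
   ℕ.+ 1) ∸ count (nV G) (component G s v)

numComp : (G : Multigraph) → Subset (nE G) → ℕ → ℕ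
numComp G s n = count (nV G) (λ v → isRep G s v ∧ (nullity G s v ≡ᵇ n))

module WithRing {c ℓ : Level} (R : CommutativeRing c ℓ) where
  open CommutativeRing R

  f : ℕ → Carrier → Carrier
  f zero          x = 1#
  f (suc zero)    x = 0#
  f (suc (suc n)) x = x * f (suc n) x + f n x

  pow : Carrier → ℕ → Carrier
  pow x zero    = 1#
  pow x (suc n) = x * pow x n

  ∏ : (k : ℕ) → (Fin k → Carrier) → Carrier
  ∏ zero    g = 1#
  ∏ (suc k) g = g Fin.zero * ∏ k (λ i → g (Fin.suc i))

  ΣSub : (m : ℕ) → (Subset m → Carrier) → Carrier
  ΣSub zero    g = g []
  ΣSub (suc m) g = ΣSub m (λ s → g (outside ∷ s)) + ΣSub m (λ s → g (inside ∷ s))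

  Θ : (G : Multigraph) → (Fin (nE G) → Carrier) → (Fin (nV G) → Carrier) → Carrier
  Θ G β γ = ΣSub (nE G) (λ s →
    ∏ (nE G) (λ e → if e ∈ᵇ s then β e else 1#) * ∏ (nV G) (λ i → f (degree G s i) (γ i)))

  θ : (G : Multigraph) → Carrier → Carrier → Carrier
  θ G b g = Θ G (λ _ → b) (λ _ → g)

  -- Π_{n ≥ 0} θ_{B_n}(1,γ)^{i_n(s)}.  Since a component's nullity is at most
  -- |E|, i_n(s) = 0 for n > |E|, so the product over n ≤ |E| is the full product.
  bouquetFactor : (G : Multigraph) → Carrier → Subset (nE G) → Carrier
  bouquetFactor G γ s =
    ∏ (suc (nE G)) (λ n → pow (θ (bouquet (toℕ n)) 1# γ) (numComp G s (toℕ n)))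

-- Since Π_{e∈t} β_e = Σ_{s ⊇ t} Π_{e∈s} β_e Π_{e∉s} (1 − β_e), the left-hand side equals
-- Σ_s Π_{e∈s} β_e Π_{e∉s} (1 − β_e) · Σ_{t ⊆ s} Π_i f_{d_i(t)}(γ), so it suffices to show that the inner sum is
-- the product, over the components C of (V, s), of θ_{B_{n(C)}}(1, γ) = Σ_j (n(C) choose j) f_{2j}(γ).
-- This is proved by induction on the edges of s in the generality where each vertex i carries a_i extra
-- half-edges: then C contributes ψ_{n(C)}(Σ_{i∈C} a_i) with ψ_k(A) = Σ_j (k choose j) f_{A+2j}(γ).
-- Splitting on whether t contains a given edge of s: an edge closing a cycle raises the nullity of its
-- component, matching ψ_{k+1}(A) = ψ_k(A) + ψ_k(A+2); a bridge merges two components, matching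
-- ψ_{k₁}(A₁) ψ_{k₂}(A₂) + ψ_{k₁}(A₁+1) ψ_{k₂}(A₂+1) = ψ_{k₁+k₂}(A₁+A₂), which comes from the addition formula
-- f_a f_b + f_{a+1} f_{b+1} = f_{a+b}.

module Submission where

open import Defs
open import Level using (Level)
import Relation.Binary.Reasoning.Setoid as SetoidReasoning
open import Data.Nat as ℕ using (ℕ; zero; suc; _∸_; _≤_; _<_; _≤′_; ≤′-refl; ≤′-step; z≤n; s≤s; _<ᵇ_; _≡ᵇ_)
import Data.Nat.Properties as ℕ
open import Data.Fin as Fin using (Fin; toℕ)
import Data.Fin.Properties as Fin
open import Data.Fin.Subset using (Subset)
open import Data.Vec using ([]; _∷_; lookup)
open import Data.Bool as Bool using (Bool; true; false; if_then_else_; _∧_; _∨_; not)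
open import Data.Bool.Properties using (¬-not; ∨-zeroʳ; ∨-identityʳ; ∨-comm; ∨-conicalˡ; ∨-conicalʳ; T-≡)
open import Function.Base using (_∘_)
open import Function.Bundles using (Equivalence)
open import Data.Product as Σ using (∃; _×_; _,_; proj₁; proj₂)
open import Data.Sum using (_⊎_; inj₁; inj₂)
open import Relation.Nullary using (yes; no; contradiction; _×-dec_)
open import Relation.Binary.Definitions using (tri<; tri≈; tri>)
open import Relation.Binary.PropositionalEquality as ≡ using (_≡_; _≢_)
open import Data.Nat.Solver using (module +-*-Solver)
open import Algebra.Bundles using (CommutativeRing)
open import Data.Maybe using (nothing)
open import Tactic.RingSolver.Core.AlmostCommutativeRing using (fromCommutativeRing)
open import Algebra.Properties.CommutativeSemigroup ℕ.+-commutativeSemigroup using (interchange)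

module _ where
  open import Data.Nat using (_+_)
  open ≡ using (refl; sym; trans; cong; cong₂; subst; module ≡-Reasoning)

  ≡-from-true⇔ : ∀ {a b : Bool} → (a ≡ true → b ≡ true) → (b ≡ true → a ≡ true) → a ≡ b
  ≡-from-true⇔ {true}  {true}  _ _ = refl
  ≡-from-true⇔ {true}  {false} f _ = sym (f refl)
  ≡-from-true⇔ {false} {true}  _ g = g refl
  ≡-from-true⇔ {false} {false} _ _ = refl

  ∨≡true⇒ : ∀ {a b} → (a ∨ b) ≡ true → a ≡ true ⊎ b ≡ true
  ∨≡true⇒ {true}  _ = inj₁ refl
  ∨≡true⇒ {false} e = inj₂ e

  ∧≡true⇒ : ∀ {a b} → (a ∧ b) ≡ true → a ≡ true × b ≡ true
  ∧≡true⇒ {true} {true} _ = refl , refl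

  true≢false : true ≢ false
  true≢false ()

  ==-refl : ∀ {n} (i : Fin n) → (i == i) ≡ true
  ==-refl i with i Fin.≟ i
  ... | yes _ = refl
  ... | no ne = contradiction refl ne

  ≡⇒== : ∀ {n} {i j : Fin n} → i ≡ j → (i == j) ≡ true
  ≡⇒== {i = i} refl = ==-refl i

  ==⇒≡ : ∀ {n} {i j : Fin n} → (i == j) ≡ true → i ≡ j
  ==⇒≡ {i = i} {j} e with i Fin.≟ j
  ... | yes eq = eq

  ≢⇒==false : ∀ {n} {i j : Fin n} → i ≢ j → (i == j) ≡ false
  ≢⇒==false ne = ¬-not (λ e → ne (==⇒≡ e))

  ==-suc : ∀ {k} (i j : Fin k) → (Fin.suc i == Fin.suc j) ≡ (i == j)
  ==-suc i j = ≡-from-true⇔ (λ e → ≡⇒== (Fin.suc-injective (==⇒≡ e))) (λ e → ≡⇒== (cong Fin.suc (==⇒≡ e)))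

  _≐_ : ∀ {n} → (Fin n → Bool) → (Fin n → Bool) → Set
  χ ≐ ψ = ∀ w → χ w ≡ ψ w

  _∪_ : ∀ {n} → (Fin n → Bool) → (Fin n → Bool) → Fin n → Bool
  (χ ∪ ψ) w = χ w ∨ ψ w

  Disjoint : ∀ {n} → (Fin n → Bool) → (Fin n → Bool) → Set
  Disjoint χ ψ = ∀ w → (χ w ∧ ψ w) ≡ false

  anyFin-true : ∀ k (P : Fin k → Bool) e → P e ≡ true → anyFin k P ≡ true
  anyFin-true (suc k) P Fin.zero    pe rewrite pe = refl
  anyFin-true (suc k) P (Fin.suc e) pe with P Fin.zero
  ... | true  = refl
  ... | false = anyFin-true k (λ i → P (Fin.suc i)) e pe

  anyFin-witness : ∀ k (P : Fin k → Bool) → anyFin k P ≡ true → ∃ λ e → P e ≡ true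
  anyFin-witness (suc k) P h with P Fin.zero in p0
  ... | true  = Fin.zero , p0
  ... | false with anyFin-witness k (λ i → P (Fin.suc i)) h
  ...   | e , pe = Fin.suc e , pe

  anyFin-false : ∀ k (P : Fin k → Bool) → (∀ e → P e ≡ false) → anyFin k P ≡ false
  anyFin-false zero    P h = refl
  anyFin-false (suc k) P h rewrite h Fin.zero = anyFin-false k (λ i → P (Fin.suc i)) (λ e → h (Fin.suc e))

  anyFin-cong : ∀ k {P Q : Fin k → Bool} → P ≐ Q → anyFin k P ≡ anyFin k Q
  anyFin-cong zero    h = refl
  anyFin-cong (suc k) h = cong₂ _∨_ (h Fin.zero) (anyFin-cong k (λ e → h (Fin.suc e)))

  sumℕ-cong : ∀ k {F H : Fin k → ℕ} → (∀ e → F e ≡ H e) → sumℕ k F ≡ sumℕ k H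
  sumℕ-cong zero    h = refl
  sumℕ-cong (suc k) h = cong₂ _+_ (h Fin.zero) (sumℕ-cong k (λ e → h (Fin.suc e)))

  sumℕ-zero : ∀ k → sumℕ k (λ _ → 0) ≡ 0
  sumℕ-zero zero    = refl
  sumℕ-zero (suc k) = sumℕ-zero k

  sumℕ-+ : ∀ k (F H : Fin k → ℕ) → sumℕ k (λ i → F i + H i) ≡ sumℕ k F + sumℕ k H
  sumℕ-+ zero    F H = refl
  sumℕ-+ (suc k) F H rewrite sumℕ-+ k (λ i → F (Fin.suc i)) (λ i → H (Fin.suc i)) =
    interchange (F Fin.zero) (H Fin.zero) _ _

  count-cong : ∀ k {P Q : Fin k → Bool} → P ≐ Q → count k P ≡ count k Q
  count-cong k h = sumℕ-cong k (λ e → cong b2n (h e))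

  count-≤ : ∀ k (P : Fin k → Bool) → count k P ≤ k
  count-≤ zero    P = z≤n
  count-≤ (suc k) P with P Fin.zero
  ... | true  = s≤s (count-≤ k _)
  ... | false = ℕ.m≤n⇒m≤1+n (count-≤ k _)

  count-pos : ∀ k (P : Fin k → Bool) e → P e ≡ true → 1 ≤ count k P
  count-pos (suc k) P Fin.zero    pe rewrite pe = s≤s z≤n
  count-pos (suc k) P (Fin.suc e) pe = ℕ.≤-trans (count-pos k _ e pe) (ℕ.m≤n+m _ (b2n (P Fin.zero)))

  count-mono : ∀ k (P Q : Fin k → Bool) → (∀ w → P w ≡ true → Q w ≡ true) → count k P ≤ count k Q
  count-mono zero    P Q h = z≤n
  count-mono (suc k) P Q h with P Fin.zero in p0 | Q Fin.zero in q0
  ... | true  | true  = s≤s (count-mono k _ _ (λ w → h (Fin.suc w)))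
  ... | true  | false = contradiction (trans (sym (h Fin.zero p0)) q0) true≢false
  ... | false | true  = ℕ.m≤n⇒m≤1+n (count-mono k _ _ (λ w → h (Fin.suc w)))
  ... | false | false = count-mono k _ _ (λ w → h (Fin.suc w))

  count-mono-< : ∀ k (P Q : Fin k → Bool) → (∀ w → P w ≡ true → Q w ≡ true) →
                 ∀ w → Q w ≡ true → P w ≡ false → count k P < count k Q
  count-mono-< (suc k) P Q h Fin.zero qw pw rewrite qw | pw =
    s≤s (count-mono k _ _ (λ w → h (Fin.suc w)))
  count-mono-< (suc k) P Q h (Fin.suc w) qw pw with P Fin.zero in p0 | Q Fin.zero in q0
  ... | true  | true  = s≤s (count-mono-< k _ _ (λ u → h (Fin.suc u)) w qw pw)
  ... | true  | false = contradiction (trans (sym (h Fin.zero p0)) q0) true≢false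
  ... | false | true  = ℕ.m≤n⇒m≤1+n (count-mono-< k _ _ (λ u → h (Fin.suc u)) w qw pw)
  ... | false | false = count-mono-< k _ _ (λ u → h (Fin.suc u)) w qw pw

  sumℕ-at : ∀ k (i : Fin k) (a : Fin k → ℕ) → sumℕ k (λ j → if i == j then a j else 0) ≡ a i
  sumℕ-at (suc k) Fin.zero a rewrite ==-refl {suc k} Fin.zero =
    trans (cong (a Fin.zero +_) (trans (sumℕ-cong k off) (sumℕ-zero k))) (ℕ.+-identityʳ _)
    where
      off : ∀ j → (if Fin.zero == Fin.suc j then a (Fin.suc j) else 0) ≡ 0
      off j rewrite ≢⇒==false {i = Fin.zero} {Fin.suc j} (λ ()) = refl
  sumℕ-at (suc k) (Fin.suc i) a rewrite ≢⇒==false {i = Fin.suc i} {Fin.zero} (λ ()) =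
    trans (sumℕ-cong k (λ j → cong (λ b → if b then a (Fin.suc j) else 0) (==-suc i j)))
          (sumℕ-at k i (λ j → a (Fin.suc j)))

  b2n-if : ∀ b → b2n b ≡ (if b then 1 else 0)
  b2n-if true  = refl
  b2n-if false = refl

  count-singleton : ∀ k (i : Fin k) → count k (i ==_) ≡ 1
  count-singleton k i = trans (sumℕ-cong k (λ j → b2n-if (i == j))) (sumℕ-at k i (λ _ → 1))

  Least : ∀ {n} → (Fin n → Bool) → Fin n → Set
  Least χ r = χ r ≡ true × (∀ u → toℕ u < toℕ r → χ u ≡ false)

  least-singleton : ∀ {n} (i : Fin n) → Least (i ==_) i
  least-singleton i = ==-refl i , λ u u<i → ≢⇒==false λ i≡u → ℕ.<-irrefl (cong toℕ (sym i≡u)) u<i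

  least-exists : ∀ {n} (χ : Fin n → Bool) w → χ w ≡ true → ∃ (Least χ)
  least-exists {suc n} χ w h with χ Fin.zero in χ0
  ... | true = Fin.zero , χ0 , λ u ()
  least-exists {suc n} χ Fin.zero    h | false = contradiction (trans (sym h) χ0) true≢false
  least-exists {suc n} χ (Fin.suc w) h | false with least-exists (λ i → χ (Fin.suc i)) w h
  ... | r , χr , below = Fin.suc r , χr , below′
    where
      below′ : ∀ u → toℕ u < toℕ (Fin.suc r) → χ u ≡ false
      below′ Fin.zero    _         = χ0
      below′ (Fin.suc u) (s≤s u<r) = below u u<r

  least-below : ∀ {n} {χ : Fin n → Bool} {r i} → Least χ r → χ i ≡ true → i ≢ r → toℕ r < toℕ i
  least-below {r = r} {i} (_ , below) χi i≢r with ℕ.<-cmp (toℕ r) (toℕ i)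
  ... | tri< r<i _ _ = r<i
  ... | tri≈ _ r≡i _ = contradiction (Fin.toℕ-injective (sym r≡i)) i≢r
  ... | tri> _ _ i<r = contradiction (trans (sym χi) (below i i<r)) true≢false

  noneBelow : ∀ {n} → Fin n → (Fin n → Bool) → Bool
  noneBelow {n} i χ = not (anyFin n (λ u → (toℕ u <ᵇ toℕ i) ∧ χ u))

  noneBelow-cong : ∀ {n} (i : Fin n) {χ ψ} → χ ≐ ψ → noneBelow i χ ≡ noneBelow i ψ
  noneBelow-cong {n} i h = cong not (anyFin-cong n (λ u → cong ((toℕ u <ᵇ toℕ i) ∧_) (h u)))

  noneBelow-false : ∀ {n} {χ : Fin n → Bool} {r i} → χ r ≡ true → toℕ r < toℕ i → noneBelow i χ ≡ false
  noneBelow-false {n} {χ} {r} {i} χr r<i = cong not (anyFin-true n _ r below)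
    where
      below : ((toℕ r <ᵇ toℕ i) ∧ χ r) ≡ true
      below rewrite Equivalence.to T-≡ (ℕ.<⇒<ᵇ r<i) = χr

  noneBelow-least : ∀ {n} {χ : Fin n → Bool} {r} → Least χ r → noneBelow r χ ≡ true
  noneBelow-least {n} {χ} {r} (_ , below) = cong not (anyFin-false n _ none)
    where
      none : ∀ u → ((toℕ u <ᵇ toℕ r) ∧ χ u) ≡ false
      none u with toℕ u <ᵇ toℕ r in lt
      ... | false = refl
      ... | true  = below u (ℕ.<ᵇ⇒< (toℕ u) (toℕ r) (Equivalence.from T-≡ lt))

  noneBelow-not-least : ∀ {n} {χ : Fin n → Bool} {r i} → Least χ r → χ i ≡ true → i ≢ r → noneBelow i χ ≡ false
  noneBelow-not-least least χi i≢r = noneBelow-false (proj₁ least) (least-below least χi i≢r)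

  least-∪ : ∀ {n} {χ ψ : Fin n → Bool} {r₁ r₂} → Least χ r₁ → Least ψ r₂ →
            Least (χ ∪ ψ) r₁ ⊎ Least (χ ∪ ψ) r₂
  least-∪ {χ = χ} {ψ} {r₁} {r₂} (χr₁ , below₁) (ψr₂ , below₂) with ℕ.≤-total (toℕ r₁) (toℕ r₂)
  ... | inj₁ r₁≤r₂ = inj₁ (cong (_∨ ψ r₁) χr₁ , λ u u<r₁ →
                            cong₂ _∨_ (below₁ u u<r₁) (below₂ u (ℕ.<-≤-trans u<r₁ r₁≤r₂)))
  ... | inj₂ r₂≤r₁ = inj₂ (trans (cong (χ r₂ ∨_) ψr₂) (∨-zeroʳ _) , λ u u<r₂ →
                            cong₂ _∨_ (below₁ u (ℕ.<-≤-trans u<r₂ r₂≤r₁)) (below₂ u u<r₂))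

  -- Connected components

  data Path {n m} (en : Fin m → Fin n × Fin n) (s : Subset m) (v : Fin n) : Fin n → Set where
    here : Path en s v v
    fwd  : ∀ e → lookup s e ≡ true → Path en s v (proj₁ (en e)) → Path en s v (proj₂ (en e))
    bwd  : ∀ e → lookup s e ≡ true → Path en s v (proj₂ (en e)) → Path en s v (proj₁ (en e))

  module _ {n m} {en : Fin m → Fin n × Fin n} {s : Subset m} where
    Path-trans : ∀ {u v w} → Path en s u v → Path en s v w → Path en s u w
    Path-trans p here          = p
    Path-trans p (fwd e se q) = fwd e se (Path-trans p q)
    Path-trans p (bwd e se q) = bwd e se (Path-trans p q)

    Path-sym : ∀ {v w} → Path en s v w → Path en s w v
    Path-sym here          = here
    Path-sym (fwd e se p) = Path-trans (bwd e se here) (Path-sym p)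
    Path-sym (bwd e se p) = Path-trans (fwd e se here) (Path-sym p)

  module Reachability (G : Multigraph) (s : Subset (nE G)) where
    private
      V = Fin (nV G)
      src tgt : Fin (nE G) → V
      src e = proj₁ (ends G e)
      tgt e = proj₂ (ends G e)

    StepWitness : (V → Bool) → V → Set
    StepWitness R w = ∃ λ e → lookup s e ≡ true ×
      ((R (src e) ≡ true × tgt e ≡ w) ⊎ (R (tgt e) ≡ true × src e ≡ w))

    step-inversion : ∀ R w → step G s R w ≡ true → R w ≡ true ⊎ StepWitness R w
    step-inversion R w h with ∨≡true⇒ {R w} h
    ... | inj₁ Rw = inj₁ Rw
    ... | inj₂ h′ with anyFin-witness (nE G) _ h′
    ...   | e , he with ∧≡true⇒ {lookup s e} he
    ...     | se , h″ with ∨≡true⇒ h″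
    ...       | inj₁ h‴ = inj₂ (e , se , inj₁ (Σ.map₂ ==⇒≡ (∧≡true⇒ {R (src e)} h‴)))
    ...       | inj₂ h‴ = inj₂ (e , se , inj₂ (Σ.map₂ ==⇒≡ (∧≡true⇒ {R (tgt e)} h‴)))

    step-keep : ∀ R w → R w ≡ true → step G s R w ≡ true
    step-keep R w Rw rewrite Rw = refl

    step-fwd : ∀ R e → lookup s e ≡ true → R (src e) ≡ true → step G s R (tgt e) ≡ true
    step-fwd R e se R-src = trans (cong (R (tgt e) ∨_) (anyFin-true (nE G) _ e edge)) (∨-zeroʳ _)
      where
        edge : (lookup s e ∧ ((R (src e) ∧ (tgt e == tgt e)) ∨ (R (tgt e) ∧ (src e == tgt e)))) ≡ true
        edge rewrite se | R-src | ==-refl (tgt e) = refl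

    step-bwd : ∀ R e → lookup s e ≡ true → R (tgt e) ≡ true → step G s R (src e) ≡ true
    step-bwd R e se R-tgt = trans (cong (R (src e) ∨_) (anyFin-true (nE G) _ e edge)) (∨-zeroʳ _)
      where
        edge : (lookup s e ∧ ((R (src e) ∧ (tgt e == src e)) ∨ (R (tgt e) ∧ (src e == src e)))) ≡ true
        edge rewrite se | R-tgt | ==-refl (src e) = ∨-zeroʳ _

    step-mono : ∀ R R′ → (∀ w → R w ≡ true → R′ w ≡ true) →
                ∀ w → step G s R w ≡ true → step G s R′ w ≡ true
    step-mono R R′ R⊆R′ w h with step-inversion R w h
    ... | inj₁ Rw = step-keep R′ w (R⊆R′ w Rw)
    ... | inj₂ (e , se , inj₁ (R-src , refl)) = step-fwd R′ e se (R⊆R′ _ R-src)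
    ... | inj₂ (e , se , inj₂ (R-tgt , refl)) = step-bwd R′ e se (R⊆R′ _ R-tgt)

    reach-sound : ∀ k v w → reach G s k v w ≡ true → Path (ends G) s v w
    reach-sound zero    v w h with ==⇒≡ {i = v} h
    ... | refl = here
    reach-sound (suc k) v w h with step-inversion (reach G s k v) w h
    ... | inj₁ r = reach-sound k v w r
    ... | inj₂ (e , se , inj₁ (r , refl)) = fwd e se (reach-sound k v (src e) r)
    ... | inj₂ (e , se , inj₂ (r , refl)) = bwd e se (reach-sound k v (tgt e) r)

    reach-complete : ∀ v w → Path (ends G) s v w → ∃ λ k → reach G s k v w ≡ true
    reach-complete v .v here = 0 , ==-refl v
    reach-complete v _ (fwd e se p) with reach-complete v _ p
    ... | k , r = suc k , step-fwd (reach G s k v) e se r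
    reach-complete v _ (bwd e se p) with reach-complete v _ p
    ... | k , r = suc k , step-bwd (reach G s k v) e se r

    module _ (v : V) where
      private
        R : ℕ → V → Bool
        R k = reach G s k v

      reach-mono : ∀ {k l} → k ≤′ l → ∀ w → R k w ≡ true → R l w ≡ true
      reach-mono ≤′-refl       w r = r
      reach-mono {l = suc l} (≤′-step k≤l) w r = step-keep (R l) w (reach-mono k≤l w r)

      Stable : ℕ → Set
      Stable k = ∀ w → R (suc k) w ≡ true → R k w ≡ true

      stable-mono : ∀ {k l} → Stable k → k ≤′ l → Stable l
      stable-mono st ≤′-refl       = st
      stable-mono {l = suc l} st (≤′-step k≤l) = step-mono (R (suc l)) (R l) (stable-mono st k≤l)

      stable-reach : ∀ {k l} → Stable k → k ≤′ l → ∀ w → R l w ≡ true → R k w ≡ true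
      stable-reach st ≤′-refl       w r = r
      stable-reach st (≤′-step k≤l) w r = stable-reach st k≤l w (stable-mono st k≤l w r)

      stable-or-grows : ∀ k → Stable k ⊎ count (nV G) (R k) < count (nV G) (R (suc k))
      stable-or-grows k with Fin.any? (λ w → (R (suc k) w Bool.≟ true) ×-dec (R k w Bool.≟ false))
      ... | yes (w , new , old) = inj₂ (count-mono-< (nV G) (R k) (R (suc k)) (step-keep (R k)) w new old)
      ... | no none = inj₁ λ w new → ¬-not (λ old → none (w , new , old))

      stable-or-large : ∀ j → (∃ λ i → i < j × Stable i) ⊎ j ≤ count (nV G) (R j)
      stable-or-large zero    = inj₂ z≤n
      stable-or-large (suc j) with stable-or-large j
      ... | inj₁ (i , i<j , st) = inj₁ (i , ℕ.m<n⇒m<1+n i<j , st)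
      ... | inj₂ j≤size with stable-or-grows j
      ...   | inj₁ st    = inj₁ (j , ℕ.n<1+n j , st)
      ...   | inj₂ grows = inj₂ (ℕ.≤-trans (s≤s j≤size) grows)

      -- Until it stabilises, every step adds a vertex.
      stabilises : ∃ λ i → i ≤ nV G × Stable i
      stabilises with stable-or-large (suc (nV G))
      ... | inj₁ (i , s≤s i≤n , st) = i , i≤n , st
      ... | inj₂ n<size = contradiction (ℕ.≤-trans n<size (count-≤ (nV G) _)) (ℕ.n≮n (nV G))

      reach⇒component : ∀ k w → R k w ≡ true → component G s v w ≡ true
      reach⇒component k w r with stabilises
      ... | i , i≤n , st with ℕ.≤-total k i
      ...   | inj₁ k≤i = reach-mono (ℕ.≤⇒≤′ (ℕ.≤-trans k≤i i≤n)) w r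
      ...   | inj₂ i≤k = reach-mono (ℕ.≤⇒≤′ i≤n) w (stable-reach st (ℕ.≤⇒≤′ i≤k) w r)

    component-sound : ∀ v w → component G s v w ≡ true → Path (ends G) s v w
    component-sound v w = reach-sound (nV G) v w

    component-complete : ∀ v w → Path (ends G) s v w → component G s v w ≡ true
    component-complete v w p with reach-complete v w p
    ... | k , r = reach⇒component v k w r

  Closed : ∀ {n m} → (Fin m → Fin n × Fin n) → Subset m → (Fin n → Bool) → Set
  Closed en s χ = ∀ e → lookup s e ≡ true → χ (proj₁ (en e)) ≡ χ (proj₂ (en e))

  module ComponentRelation (G : Multigraph) (s : Subset (nE G)) where
    open Reachability G s using (component-sound; component-complete)
    private
      c = component G s

    component-refl : ∀ v → c v v ≡ true
    component-refl v = component-complete v v here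

    component-sym : ∀ v w → c v w ≡ c w v
    component-sym v w = ≡-from-true⇔ (λ h → component-complete w v (Path-sym (component-sound v w h)))
                                     (λ h → component-complete v w (Path-sym (component-sound w v h)))

    component-trans : ∀ u v w → c u v ≡ true → c v w ≡ true → c u w ≡ true
    component-trans u v w h h′ = component-complete u w (Path-trans (component-sound u v h) (component-sound v w h′))

    component-class : ∀ u v → c u v ≡ true → c u ≐ c v
    component-class u v h w = ≡-from-true⇔ (component-trans v u w (trans (component-sym v u) h))
                                           (component-trans u v w h)

    component-closed : ∀ v → Closed (ends G) s (c v)
    component-closed v e se = ≡-from-true⇔ (λ h → component-trans v _ _ h (component-complete _ _ (fwd e se here)))
                                           (λ h → component-trans v _ _ h (component-complete _ _ (bwd e se here)))

  graphOf : ∀ {n m} → (Fin m → Fin n × Fin n) → Multigraph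
  graphOf {n} {m} en = record { nV = n ; nE = m ; ends = en }

  component-empty : ∀ {n} (en : Fin 0 → Fin n × Fin n) v → component (graphOf en) [] v ≐ (v ==_)
  component-empty en v w = ≡-from-true⇔ (λ h → ≡⇒== (trivial (component-sound v w h)))
                                        (λ h → component-complete v w (subst (Path en [] v) (==⇒≡ h) here))
    where
      open Reachability (graphOf en) []
      trivial : ∀ {w} → Path en [] v w → v ≡ w
      trivial here = refl

  module FirstEdge {n m} (en : Fin (suc m) → Fin n × Fin n) where
    en′ : Fin m → Fin n × Fin n
    en′ e = en (Fin.suc e)

    p₀ q₀ : Fin n
    p₀ = proj₁ (en Fin.zero)
    q₀ = proj₂ (en Fin.zero)

    Path-lift : ∀ {b s v w} → Path en′ s v w → Path en (b ∷ s) v w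
    Path-lift here          = here
    Path-lift (fwd e se p) = fwd (Fin.suc e) se (Path-lift p)
    Path-lift (bwd e se p) = bwd (Fin.suc e) se (Path-lift p)

    Path-unlift : ∀ {s v w} → Path en (false ∷ s) v w → Path en′ s v w
    Path-unlift here                    = here
    Path-unlift (fwd (Fin.suc e) se p) = fwd e se (Path-unlift p)
    Path-unlift (bwd (Fin.suc e) se p) = bwd e se (Path-unlift p)

    component-outside : ∀ s v → component (graphOf en) (false ∷ s) v ≐ component (graphOf en′) s v
    component-outside s v w = ≡-from-true⇔
      (λ h → R′.component-complete v w (Path-unlift (R.component-sound v w h)))
      (λ h → R.component-complete v w (Path-lift (R′.component-sound v w h)))
      where
        module R  = Reachability (graphOf en) (false ∷ s)
        module R′ = Reachability (graphOf en′) s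

    module _ (s : Subset m) where
      private
        P′ = Path en′ s

      ViaFirstEdge : Fin n → Fin n → Set
      ViaFirstEdge v w = P′ v w ⊎ ((P′ v p₀ × P′ q₀ w) ⊎ (P′ v q₀ × P′ p₀ w))

      via-append : ∀ {v u w} → ViaFirstEdge v u → P′ u w → ViaFirstEdge v w
      via-append (inj₁ p)               q = inj₁ (Path-trans p q)
      via-append (inj₂ (inj₁ (p , p′))) q = inj₂ (inj₁ (p , Path-trans p′ q))
      via-append (inj₂ (inj₂ (p , p′))) q = inj₂ (inj₂ (p , Path-trans p′ q))

      via-inversion : ∀ {v w} → Path en (true ∷ s) v w → ViaFirstEdge v w
      via-inversion here = inj₁ here
      via-inversion (fwd Fin.zero _ p) with via-inversion p
      ... | inj₁ p′               = inj₂ (inj₁ (p′ , here))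
      ... | inj₂ (inj₁ (p′ , _))  = inj₂ (inj₁ (p′ , here))
      ... | inj₂ (inj₂ (p′ , _))  = inj₁ p′
      via-inversion (bwd Fin.zero _ p) with via-inversion p
      ... | inj₁ p′               = inj₂ (inj₂ (p′ , here))
      ... | inj₂ (inj₁ (p′ , _))  = inj₁ p′
      ... | inj₂ (inj₂ (p′ , _))  = inj₂ (inj₂ (p′ , here))
      via-inversion (fwd (Fin.suc e) se p) = via-append (via-inversion p) (fwd e se here)
      via-inversion (bwd (Fin.suc e) se p) = via-append (via-inversion p) (bwd e se here)

      via-path : ∀ {v w} → ViaFirstEdge v w → Path en (true ∷ s) v w
      via-path (inj₁ p)               = Path-lift p
      via-path (inj₂ (inj₁ (p , p′))) = Path-trans (fwd Fin.zero refl (Path-lift p)) (Path-lift p′)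
      via-path (inj₂ (inj₂ (p , p′))) = Path-trans (bwd Fin.zero refl (Path-lift p)) (Path-lift p′)

      private
        module R  = Reachability (graphOf en) (true ∷ s)
        module R′ = Reachability (graphOf en′) s
        c′ = component (graphOf en′) s

      component-inside : ∀ v w → component (graphOf en) (true ∷ s) v w
                                 ≡ (c′ v w ∨ ((c′ v p₀ ∧ c′ q₀ w) ∨ (c′ v q₀ ∧ c′ p₀ w)))
      component-inside v w = ≡-from-true⇔ (λ h → via⇒ (via-inversion (R.component-sound v w h)))
                                          (λ h → R.component-complete v w (via-path (⇒via h)))
        where
          via⇒ : ViaFirstEdge v w → (c′ v w ∨ ((c′ v p₀ ∧ c′ q₀ w) ∨ (c′ v q₀ ∧ c′ p₀ w))) ≡ true
          via⇒ (inj₁ p) rewrite R′.component-complete _ _ p = refl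
          via⇒ (inj₂ (inj₁ (p , p′)))
            rewrite R′.component-complete _ _ p | R′.component-complete _ _ p′ = ∨-zeroʳ _
          via⇒ (inj₂ (inj₂ (p , p′)))
            rewrite R′.component-complete _ _ p | R′.component-complete _ _ p′ | ∨-zeroʳ (c′ v p₀ ∧ c′ q₀ w) =
            ∨-zeroʳ _
          ⇒via : (c′ v w ∨ ((c′ v p₀ ∧ c′ q₀ w) ∨ (c′ v q₀ ∧ c′ p₀ w))) ≡ true → ViaFirstEdge v w
          ⇒via h with ∨≡true⇒ {c′ v w} h
          ... | inj₁ h₁ = inj₁ (R′.component-sound _ _ h₁)
          ... | inj₂ h₂ with ∨≡true⇒ {c′ v p₀ ∧ c′ q₀ w} h₂
          ...   | inj₁ h₃ = inj₂ (inj₁ ( R′.component-sound _ _ (proj₁ (∧≡true⇒ h₃))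
                                       , R′.component-sound _ _ (proj₂ (∧≡true⇒ {c′ v p₀} h₃))))
          ...   | inj₂ h₃ = inj₂ (inj₂ ( R′.component-sound _ _ (proj₁ (∧≡true⇒ h₃))
                                       , R′.component-sound _ _ (proj₂ (∧≡true⇒ {c′ v q₀} h₃))))

  edgeCount : ∀ {n m} → (Fin m → Fin n × Fin n) → Subset m → (Fin n → Bool) → ℕ
  edgeCount {m = m} en s χ = count m (λ e → lookup s e ∧ (χ (proj₁ (en e)) ∧ χ (proj₂ (en e))))

  size : ∀ {n} → (Fin n → Bool) → ℕ
  size {n} χ = count n χ

  offset : ∀ {n} → (Fin n → ℕ) → (Fin n → Bool) → ℕ
  offset {n} a χ = sumℕ n (λ j → if χ j then a j else 0)

  -- nullity G s v and isRep G s v unfold to nullityOf (ends G) s (component G s v) and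
  -- noneBelow v (component G s v).
  nullityOf : ∀ {n m} → (Fin m → Fin n × Fin n) → Subset m → (Fin n → Bool) → ℕ
  nullityOf en s χ = (edgeCount en s χ + 1) ∸ size χ

  module _ {n : ℕ} where
    edgeCount-cong : ∀ {m} (en : Fin m → Fin n × Fin n) s {χ ψ} → χ ≐ ψ → edgeCount en s χ ≡ edgeCount en s ψ
    edgeCount-cong {m} en s h = count-cong m (λ e → cong₂ (λ x y → lookup s e ∧ (x ∧ y)) (h _) (h _))

    size-cong : ∀ {χ ψ : Fin n → Bool} → χ ≐ ψ → size χ ≡ size ψ
    size-cong = count-cong n

    offset-cong : ∀ a {χ ψ : Fin n → Bool} → χ ≐ ψ → offset a χ ≡ offset a ψ
    offset-cong a h = sumℕ-cong n (λ j → cong (λ b → if b then a j else 0) (h j))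

    nullityOf-cong : ∀ {m} (en : Fin m → Fin n × Fin n) s {χ ψ} → χ ≐ ψ → nullityOf en s χ ≡ nullityOf en s ψ
    nullityOf-cong en s h = cong₂ (λ x y → (x + 1) ∸ y) (edgeCount-cong en s h) (size-cong h)

    private
      if-∨ : ∀ x y k → (x ∧ y) ≡ false → (if x ∨ y then k else 0) ≡ (if x then k else 0) + (if y then k else 0)
      if-∨ true  false k _ = sym (ℕ.+-identityʳ k)
      if-∨ false y     k _ = refl

    offset-∪ : ∀ a {χ ψ : Fin n → Bool} → Disjoint χ ψ → offset a (χ ∪ ψ) ≡ offset a χ + offset a ψ
    offset-∪ a {χ} {ψ} χ∩ψ = trans (sumℕ-cong n (λ j → if-∨ (χ j) (ψ j) (a j) (χ∩ψ j))) (sumℕ-+ n _ _)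

    size-bound-cong : ∀ {m} (en : Fin m → Fin n × Fin n) s {χ ψ} → χ ≐ ψ →
                      size ψ ≤ edgeCount en s ψ + 1 → size χ ≤ edgeCount en s χ + 1
    size-bound-cong en s χ≐ψ rewrite size-cong χ≐ψ | edgeCount-cong en s χ≐ψ = λ bound → bound

    size-as-offset : ∀ (χ : Fin n → Bool) → size χ ≡ offset (λ _ → 1) χ
    size-as-offset χ = sumℕ-cong n (λ j → b2n-if (χ j))

    size-∪ : ∀ {χ ψ : Fin n → Bool} → Disjoint χ ψ → size (χ ∪ ψ) ≡ size χ + size ψ
    size-∪ {χ} {ψ} χ∩ψ = begin
      size (χ ∪ ψ)                                  ≡⟨ size-as-offset (χ ∪ ψ) ⟩
      offset (λ _ → 1) (χ ∪ ψ)                      ≡⟨ offset-∪ (λ _ → 1) χ∩ψ ⟩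
      offset (λ _ → 1) χ + offset (λ _ → 1) ψ       ≡⟨ sym (cong₂ _+_ (size-as-offset χ) (size-as-offset ψ)) ⟩
      size χ + size ψ                               ∎
      where open ≡-Reasoning

    edgeCount-∪ : ∀ {m} (en : Fin m → Fin n × Fin n) s {χ ψ} → Disjoint χ ψ → Closed en s χ → Closed en s ψ →
                  edgeCount en s (χ ∪ ψ) ≡ edgeCount en s χ + edgeCount en s ψ
    edgeCount-∪ {m} en s {χ} {ψ} χ∩ψ χ-closed ψ-closed = trans (sumℕ-cong m per-edge) (sumℕ-+ m _ _)
      where
        split : ∀ x y → (x ∧ y) ≡ false → b2n ((x ∨ y) ∧ (x ∨ y)) ≡ b2n (x ∧ x) + b2n (y ∧ y)
        split true  false _ = refl
        split false true  _ = refl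
        split false false _ = refl
        per-edge : ∀ e → b2n (lookup s e ∧ ((χ ∪ ψ) (proj₁ (en e)) ∧ (χ ∪ ψ) (proj₂ (en e))))
                       ≡ b2n (lookup s e ∧ (χ (proj₁ (en e)) ∧ χ (proj₂ (en e))))
                         + b2n (lookup s e ∧ (ψ (proj₁ (en e)) ∧ ψ (proj₂ (en e))))
        per-edge e with lookup s e in se
        ... | false = refl
        ... | true rewrite sym (χ-closed e se) | sym (ψ-closed e se) =
          split (χ (proj₁ (en e))) (ψ (proj₁ (en e))) (χ∩ψ _)

    offset-indicator : ∀ (χ : Fin n → Bool) p → offset (λ j → b2n (p == j)) χ ≡ b2n (χ p)
    offset-indicator χ p = trans (sumℕ-cong n (λ j → swap (χ j) (p == j))) (sumℕ-at n p (λ j → b2n (χ j)))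
      where
        swap : ∀ x y → (if x then b2n y else 0) ≡ (if y then b2n x else 0)
        swap true  true  = refl
        swap true  false = refl
        swap false true  = refl
        swap false false = refl

    offset-+ : ∀ a b (χ : Fin n → Bool) → offset (λ j → a j + b j) χ ≡ offset a χ + offset b χ
    offset-+ a b χ = trans (sumℕ-cong n (λ j → split (χ j))) (sumℕ-+ n _ _)
      where
        split : ∀ x {k l} → (if x then k + l else 0) ≡ (if x then k else 0) + (if x then l else 0)
        split true  = refl
        split false = refl

    offset-zero : ∀ (χ : Fin n → Bool) → offset (λ _ → 0) χ ≡ 0
    offset-zero χ = trans (sumℕ-cong n (λ j → zero-either (χ j))) (sumℕ-zero n)
      where
        zero-either : ∀ b → (if b then 0 else 0) ≡ 0
        zero-either true  = refl
        zero-either false = refl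

    offset-shift : ∀ a (p q : Fin n) χ →
                   offset (λ j → a j + (b2n (p == j) + b2n (q == j))) χ ≡ offset a χ + (b2n (χ p) + b2n (χ q))
    offset-shift a p q χ = trans (offset-+ a _ χ)
      (cong (offset a χ +_) (trans (offset-+ _ _ χ) (cong₂ _+_ (offset-indicator χ p) (offset-indicator χ q))))

  +1-+-+1 : ∀ x y → (x + 1) + (y + 1) ≡ suc (x + y) + 1
  +1-+-+1 = solve 2 (λ x y → (x :+ con 1) :+ (y :+ con 1) := (con 1 :+ (x :+ y)) :+ con 1) refl
    where open +-*-Solver

  nullity-∪ : ∀ E₁ E₂ V₁ V₂ → V₁ ≤ E₁ + 1 → V₂ ≤ E₂ + 1 →
              (suc (E₁ + E₂) + 1) ∸ (V₁ + V₂) ≡ ((E₁ + 1) ∸ V₁) + ((E₂ + 1) ∸ V₂)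
  nullity-∪ E₁ E₂ V₁ V₂ V₁≤ V₂≤ =
    trans (cong (_∸ (V₁ + V₂)) regroup) (ℕ.m+n∸n≡m (k₁ + k₂) (V₁ + V₂))
    where
      k₁ = (E₁ + 1) ∸ V₁
      k₂ = (E₂ + 1) ∸ V₂
      regroup : suc (E₁ + E₂) + 1 ≡ (k₁ + k₂) + (V₁ + V₂)
      regroup = begin
        suc (E₁ + E₂) + 1          ≡⟨ sym (+1-+-+1 E₁ E₂) ⟩
        (E₁ + 1) + (E₂ + 1)        ≡⟨ cong₂ _+_ (sym (ℕ.m∸n+n≡m V₁≤)) (sym (ℕ.m∸n+n≡m V₂≤)) ⟩
        (k₁ + V₁) + (k₂ + V₂)      ≡⟨ interchange k₁ V₁ k₂ V₂ ⟩
        (k₁ + k₂) + (V₁ + V₂)      ∎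
        where open ≡-Reasoning

  module AddEdge {n m} (en : Fin (suc m) → Fin n × Fin n) (s : Subset m) where
    open FirstEdge en public
    open ComponentRelation (graphOf en′) s public

    c c′ : Fin n → Fin n → Bool
    c  = component (graphOf en) (true ∷ s)
    c′ = component (graphOf en′) s

    cycle-class : c′ p₀ q₀ ≡ true → ∀ i → c i ≐ c′ i
    cycle-class p₀~q₀ i w = ≡-from-true⇔ to (λ h → trans (component-inside s i w) (cong (_∨ via-edge) h))
      where
        via-edge = (c′ i p₀ ∧ c′ q₀ w) ∨ (c′ i q₀ ∧ c′ p₀ w)
        to : c i w ≡ true → c′ i w ≡ true
        to h with ∨≡true⇒ {c′ i w} (trans (sym (component-inside s i w)) h)
        ... | inj₁ h₁ = h₁
        ... | inj₂ h₂ with ∨≡true⇒ {c′ i p₀ ∧ c′ q₀ w} h₂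
        ...   | inj₁ h₃ = component-trans i p₀ w (proj₁ (∧≡true⇒ h₃))
                            (component-trans p₀ q₀ w p₀~q₀ (proj₂ (∧≡true⇒ {c′ i p₀} h₃)))
        ...   | inj₂ h₃ = component-trans i q₀ w (proj₁ (∧≡true⇒ h₃))
                            (component-trans q₀ p₀ w (trans (component-sym q₀ p₀) p₀~q₀)
                                                     (proj₂ (∧≡true⇒ {c′ i q₀} h₃)))

    untouched-class : ∀ i → c′ i p₀ ≡ false → c′ i q₀ ≡ false → c i ≐ c′ i
    untouched-class i i≁p₀ i≁q₀ w rewrite component-inside s i w | i≁p₀ | i≁q₀ = ∨-identityʳ _

    module Bridge (p₀≁q₀ : c′ p₀ q₀ ≡ false) where
      merged : Fin n → Bool
      merged = c′ p₀ ∪ c′ q₀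

      ≁q₀ : ∀ i → c′ i p₀ ≡ true → c′ i q₀ ≡ false
      ≁q₀ i i~p₀ = ¬-not λ i~q₀ →
        true≢false (trans (sym (component-trans p₀ i q₀ (trans (component-sym p₀ i) i~p₀) i~q₀)) p₀≁q₀)

      disjoint : Disjoint (c′ p₀) (c′ q₀)
      disjoint w = ¬-not λ h →
        true≢false (trans (sym (component-trans p₀ w q₀ (proj₁ (∧≡true⇒ h))
                                 (trans (component-sym w q₀) (proj₂ (∧≡true⇒ {c′ p₀ w} h))))) p₀≁q₀)

      merged-class : ∀ i → (c′ i p₀ ∨ c′ i q₀) ≡ true → c i ≐ merged
      merged-class i h w with c′ i p₀ in i~p₀
      ... | true rewrite component-inside s i w | i~p₀ | ≁q₀ i i~p₀ =
        trans (cong (c′ i w ∨_) (∨-identityʳ _)) (cong (_∨ c′ q₀ w) (component-class i p₀ i~p₀ w))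
      ... | false rewrite component-inside s i w | i~p₀ | h =
        trans (cong (_∨ c′ p₀ w) (component-class i q₀ h w)) (∨-comm (c′ q₀ w) (c′ p₀ w))

      merged-edgeCount : edgeCount en (true ∷ s) merged
                         ≡ suc (edgeCount en′ s (c′ p₀) + edgeCount en′ s (c′ q₀))
      merged-edgeCount =
        cong₂ _+_ (cong b2n (cong₂ _∧_ p₀∈ q₀∈))
                  (edgeCount-∪ en′ s {c′ p₀} {c′ q₀} disjoint (component-closed p₀) (component-closed q₀))
        where
          p₀∈ : merged p₀ ≡ true
          p₀∈ = cong (_∨ c′ q₀ p₀) (component-refl p₀)
          q₀∈ : merged q₀ ≡ true
          q₀∈ = trans (cong (c′ p₀ q₀ ∨_) (component-refl q₀)) (∨-zeroʳ _)

    module _ (IH : ∀ i → size (c′ i) ≤ edgeCount en′ s (c′ i) + 1) where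
      private
        IH-weakened : ∀ i → size (c′ i) ≤ edgeCount en (true ∷ s) (c′ i) + 1
        IH-weakened i = ℕ.≤-trans (IH i) (ℕ.+-monoˡ-≤ 1 (ℕ.m≤n+m _ _))

        merged-bound : (p₀≁q₀ : c′ p₀ q₀ ≡ false) →
                       size (Bridge.merged p₀≁q₀) ≤ edgeCount en (true ∷ s) (Bridge.merged p₀≁q₀) + 1
        merged-bound p₀≁q₀ = begin
          size merged                                              ≡⟨ size-∪ disjoint ⟩
          size (c′ p₀) + size (c′ q₀)                              ≤⟨ ℕ.+-mono-≤ (IH p₀) (IH q₀) ⟩
          (edgeCount en′ s (c′ p₀) + 1) + (edgeCount en′ s (c′ q₀) + 1) ≡⟨ +1-+-+1 (edgeCount en′ s (c′ p₀)) _ ⟩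
          suc (edgeCount en′ s (c′ p₀) + edgeCount en′ s (c′ q₀)) + 1  ≡⟨ cong (_+ 1) (sym merged-edgeCount) ⟩
          edgeCount en (true ∷ s) merged + 1                       ∎
          where
            open Bridge p₀≁q₀
            open ℕ.≤-Reasoning

      size-bound-step : ∀ i → size (c i) ≤ edgeCount en (true ∷ s) (c i) + 1
      size-bound-step i with c′ p₀ q₀ in p₀~q₀
      ... | true = size-bound-cong en (true ∷ s) (cycle-class p₀~q₀ i) (IH-weakened i)
      ... | false with c′ i p₀ ∨ c′ i q₀ in touched
      ...   | true  = size-bound-cong en (true ∷ s) (Bridge.merged-class p₀~q₀ i touched) (merged-bound p₀~q₀)
      ...   | false = size-bound-cong en (true ∷ s)
                        (untouched-class i (∨-conicalˡ _ _ touched) (∨-conicalʳ _ _ touched)) (IH-weakened i)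

  -- Hence the subtraction in nullityOf never truncates.
  component-size-bound : ∀ {n m} (en : Fin m → Fin n × Fin n) s i →
    size (component (graphOf en) s i) ≤ edgeCount en s (component (graphOf en) s i) + 1
  component-size-bound {n} {zero} en [] i =
    ℕ.≤-reflexive (trans (size-cong (component-empty en i)) (count-singleton n i))
  component-size-bound {m = suc m} en (false ∷ s) i =
    size-bound-cong en (false ∷ s) (FirstEdge.component-outside en s i) (component-size-bound (FirstEdge.en′ en) s i)
  component-size-bound {m = suc m} en (true ∷ s) i =
    AddEdge.size-bound-step en s (component-size-bound (FirstEdge.en′ en) s) i

  nullity-≤-edges : ∀ {n m} (en : Fin m → Fin n × Fin n) s v →
                    nullityOf en s (component (graphOf en) s v) ≤ m
  nullity-≤-edges {n} {m} en s v = begin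
    (E + 1) ∸ size (component (graphOf en) s v) ≤⟨ ℕ.∸-monoʳ-≤ (E + 1) (count-pos n _ v (component-refl v)) ⟩
    (E + 1) ∸ 1                                 ≡⟨ ℕ.m+n∸n≡m E 1 ⟩
    E                                           ≤⟨ count-≤ m _ ⟩
    m                                           ∎
    where
      open ℕ.≤-Reasoning
      open ComponentRelation (graphOf en) s using (component-refl)
      E = edgeCount en s (component (graphOf en) s v)

module WithCommutativeRing {κ ℓ} (R : CommutativeRing κ ℓ) where
  open CommutativeRing R
  open WithRing R
  open import Tactic.RingSolver.NonReflective (fromCommutativeRing R (λ _ → nothing))
  open SetoidReasoning setoid

  f-+ : ∀ x a b → f a x * f b x + f (suc a) x * f (suc b) x ≈ f (a ℕ.+ b) x
  f-+ x zero    b = trans (+-cong (*-identityˡ (f b x)) (zeroˡ (f (suc b) x))) (+-identityʳ (f b x))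
  f-+ x (suc a) b = begin
    f (suc a) x * f b x + (x * f (suc a) x + f a x) * f (suc b) x
      ≈⟨ solve 5 (λ fa′ fb fb′ y fa → (fa′ ⊗ fb ⊕ (y ⊗ fa′ ⊕ fa) ⊗ fb′)
                                     ⊜ (fa ⊗ fb′ ⊕ fa′ ⊗ (y ⊗ fb′ ⊕ fb)))
                 refl (f (suc a) x) (f b x) (f (suc b) x) x (f a x) ⟩
    f a x * f (suc b) x + f (suc a) x * f (suc (suc b)) x
      ≈⟨ f-+ x a (suc b) ⟩
    f (a ℕ.+ suc b) x
      ≡⟨ ≡.cong (λ k → f k x) (ℕ.+-suc a b) ⟩
    f (suc (a ℕ.+ b)) x ∎

  -- Products and subset sums

  ∏-cong : ∀ k {X Y : Fin k → Carrier} → (∀ i → X i ≈ Y i) → ∏ k X ≈ ∏ k Y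
  ∏-cong zero    eq = refl
  ∏-cong (suc k) eq = *-cong (eq Fin.zero) (∏-cong k (λ i → eq (Fin.suc i)))

  ∏-1 : ∀ k {X : Fin k → Carrier} → (∀ i → X i ≈ 1#) → ∏ k X ≈ 1#
  ∏-1 zero    eq = refl
  ∏-1 (suc k) eq = trans (*-cong (eq Fin.zero) (∏-1 k (λ i → eq (Fin.suc i)))) (*-identityˡ 1#)

  ∏-* : ∀ k (X Y : Fin k → Carrier) → ∏ k (λ i → X i * Y i) ≈ ∏ k X * ∏ k Y
  ∏-* zero    X Y = sym (*-identityˡ 1#)
  ∏-* (suc k) X Y = trans (*-cong refl (∏-* k (λ i → X (Fin.suc i)) (λ i → Y (Fin.suc i))))
                          (solve 4 (λ a b c d → ((a ⊗ b) ⊗ (c ⊗ d)) ⊜ ((a ⊗ c) ⊗ (b ⊗ d))) refl _ _ _ _)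

  ∏-comm : ∀ k l (X : Fin k → Fin l → Carrier) → ∏ k (λ i → ∏ l (X i)) ≈ ∏ l (λ j → ∏ k (λ i → X i j))
  ∏-comm zero    l X = sym (∏-1 l (λ _ → refl))
  ∏-comm (suc k) l X = trans (*-cong refl (∏-comm k l (λ i → X (Fin.suc i))))
                             (sym (∏-* l (X Fin.zero) (λ j → ∏ k (λ i → X (Fin.suc i) j))))

  pow-count : ∀ k x (P : Fin k → Bool) → pow x (count k P) ≈ ∏ k (λ i → if P i then x else 1#)
  pow-count zero    x P = refl
  pow-count (suc k) x P with P Fin.zero
  ... | true  = *-cong refl (pow-count k x (λ i → P (Fin.suc i)))
  ... | false = trans (pow-count k x (λ i → P (Fin.suc i))) (sym (*-identityˡ _))

  pow-cong : ∀ {x y} k → x ≈ y → pow x k ≈ pow y k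
  pow-cong zero    _   = refl
  pow-cong (suc k) x≈y = *-cong x≈y (pow-cong k x≈y)

  ∏-at : ∀ k (X : ℕ → Carrier) {N} → N ℕ.< k → ∏ k (λ j → if N ≡ᵇ toℕ j then X (toℕ j) else 1#) ≈ X N
  ∏-at (suc k) X {zero}  _         = trans (*-cong refl (∏-1 k (λ _ → refl))) (*-identityʳ _)
  ∏-at (suc k) X {suc N} (s≤s N<k) = trans (*-identityˡ _) (∏-at k (λ j → X (suc j)) N<k)

  punch : ∀ {k} → Fin k → (Fin k → Carrier) → Fin k → Carrier
  punch r X i = if i == r then 1# else X i

  punch-here : ∀ {k} r (X : Fin k → Carrier) → punch r X r ≈ 1#
  punch-here r X rewrite ==-refl r = refl

  punch-there : ∀ {k} r {i} (X : Fin k → Carrier) → i ≢ r → punch r X i ≈ X i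
  punch-there r X i≢r rewrite ≢⇒==false i≢r = refl

  punch-suc : ∀ {k} r (X : Fin (suc k) → Carrier) i → punch (Fin.suc r) X (Fin.suc i) ≈ punch r (λ j → X (Fin.suc j)) i
  punch-suc r X i = reflexive (≡.cong (λ b → if b then 1# else X (Fin.suc i)) (==-suc i r))

  punch-cong : ∀ {k} r (X Y : Fin k → Carrier) i → (i ≢ r → X i ≈ Y i) → punch r X i ≈ punch r Y i
  punch-cong r X Y i eq with i == r in i=r
  ... | true  = refl
  ... | false = eq (λ i≡r → true≢false (≡.trans (≡.sym (≡⇒== i≡r)) i=r))

  ∏-extract : ∀ k (X : Fin k → Carrier) r → ∏ k X ≈ X r * ∏ k (punch r X)
  ∏-extract (suc k) X Fin.zero = *-cong refl (begin
    ∏ k (λ i → X (Fin.suc i))                                         ≈⟨ sym (*-identityˡ _) ⟩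
    1# * ∏ k (λ i → X (Fin.suc i))                                    ≈⟨ *-cong (sym (punch-here Fin.zero X))
                                                                           (∏-cong k (λ i → sym (punch-there Fin.zero X λ ()))) ⟩
    punch Fin.zero X Fin.zero * ∏ k (λ i → punch Fin.zero X (Fin.suc i)) ∎)
  ∏-extract (suc k) X (Fin.suc r) = begin
    X Fin.zero * ∏ k X′                     ≈⟨ *-cong refl (∏-extract k X′ r) ⟩
    X Fin.zero * (X′ r * ∏ k (punch r X′))  ≈⟨ solve 3 (λ x y z → (x ⊗ (y ⊗ z)) ⊜ (y ⊗ (x ⊗ z))) refl _ _ _ ⟩
    X′ r * (X Fin.zero * ∏ k (punch r X′))  ≈⟨ *-cong refl (*-cong (sym (punch-there (Fin.suc r) X λ ()))
                                                                 (∏-cong k (λ i → sym (punch-suc r X i)))) ⟩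
    X′ r * (punch (Fin.suc r) X Fin.zero * ∏ k (λ i → punch (Fin.suc r) X (Fin.suc i))) ∎
    where X′ = λ i → X (Fin.suc i)

  ∏-split-at : ∀ k (X Y Z : Fin k → Carrier) r → (∀ i → i ≢ r → X i ≈ Y i × X i ≈ Z i) →
               X r ≈ Y r + Z r → ∏ k X ≈ ∏ k Y + ∏ k Z
  ∏-split-at k X Y Z r off at-r = begin
    ∏ k X                                           ≈⟨ ∏-extract k X r ⟩
    X r * ∏ k (punch r X)                           ≈⟨ *-cong at-r refl ⟩
    (Y r + Z r) * ∏ k (punch r X)                   ≈⟨ distribʳ _ _ _ ⟩
    Y r * ∏ k (punch r X) + Z r * ∏ k (punch r X)   ≈⟨ +-cong (*-cong refl (∏-cong k (agree proj₁)))
                                                              (*-cong refl (∏-cong k (agree proj₂))) ⟩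
    Y r * ∏ k (punch r Y) + Z r * ∏ k (punch r Z)   ≈⟨ +-cong (sym (∏-extract k Y r)) (sym (∏-extract k Z r)) ⟩
    ∏ k Y + ∏ k Z                                   ∎
    where
      agree : ∀ {W} → (∀ {i} → X i ≈ Y i × X i ≈ Z i → X i ≈ W i) → ∀ i → punch r X i ≈ punch r W i
      agree {W} pick i = punch-cong r X W i (λ i≢r → pick (off i i≢r))

  ∏-extract₂ : ∀ k (X : Fin k → Carrier) {r₁ r₂} → r₁ ≢ r₂ →
               ∏ k X ≈ (X r₁ * X r₂) * ∏ k (punch r₂ (punch r₁ X))
  ∏-extract₂ k X {r₁} {r₂} r₁≢r₂ = begin
    ∏ k X                                                 ≈⟨ ∏-extract k X r₁ ⟩
    X r₁ * ∏ k (punch r₁ X)                               ≈⟨ *-cong refl (∏-extract k (punch r₁ X) r₂) ⟩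
    X r₁ * (punch r₁ X r₂ * ∏ k (punch r₂ (punch r₁ X)))  ≈⟨ *-cong refl (*-cong (punch-there r₁ X (r₁≢r₂ ∘ ≡.sym)) refl) ⟩
    X r₁ * (X r₂ * ∏ k (punch r₂ (punch r₁ X)))           ≈⟨ sym (*-assoc _ _ _) ⟩
    (X r₁ * X r₂) * ∏ k (punch r₂ (punch r₁ X))           ∎

  ∏-split-at₂ : ∀ k (X Y Z : Fin k → Carrier) {r₁ r₂} → r₁ ≢ r₂ →
                (∀ i → i ≢ r₁ → i ≢ r₂ → X i ≈ Y i × X i ≈ Z i) →
                X r₁ * X r₂ ≈ Y r₁ * Y r₂ + Z r₁ * Z r₂ → ∏ k X ≈ ∏ k Y + ∏ k Z
  ∏-split-at₂ k X Y Z {r₁} {r₂} r₁≢r₂ off at-r = begin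
    ∏ k X                                                       ≈⟨ ∏-extract₂ k X r₁≢r₂ ⟩
    (X r₁ * X r₂) * P X                                         ≈⟨ *-cong at-r refl ⟩
    (Y r₁ * Y r₂ + Z r₁ * Z r₂) * P X                           ≈⟨ distribʳ _ _ _ ⟩
    (Y r₁ * Y r₂) * P X + (Z r₁ * Z r₂) * P X                   ≈⟨ +-cong (*-cong refl (∏-cong k (agree proj₁)))
                                                                          (*-cong refl (∏-cong k (agree proj₂))) ⟩
    (Y r₁ * Y r₂) * P Y + (Z r₁ * Z r₂) * P Z                   ≈⟨ +-cong (sym (∏-extract₂ k Y r₁≢r₂))
                                                                          (sym (∏-extract₂ k Z r₁≢r₂)) ⟩
    ∏ k Y + ∏ k Z                                               ∎
    where
      P : (Fin k → Carrier) → Carrier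
      P W = ∏ k (punch r₂ (punch r₁ W))
      agree : ∀ {W} → (∀ {i} → X i ≈ Y i × X i ≈ Z i → X i ≈ W i) →
              ∀ i → punch r₂ (punch r₁ X) i ≈ punch r₂ (punch r₁ W) i
      agree {W} pick i = punch-cong r₂ (punch r₁ X) (punch r₁ W) i λ i≢r₂ →
                         punch-cong r₁ X W i λ i≢r₁ → pick (off i i≢r₁ i≢r₂)

  ΣSub-cong : ∀ m {F H : Subset m → Carrier} → (∀ s → F s ≈ H s) → ΣSub m F ≈ ΣSub m H
  ΣSub-cong zero    eq = eq []
  ΣSub-cong (suc m) eq = +-cong (ΣSub-cong m (λ s → eq _)) (ΣSub-cong m (λ s → eq _))

  ΣSub-+ : ∀ m (F H : Subset m → Carrier) → ΣSub m (λ s → F s + H s) ≈ ΣSub m F + ΣSub m H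
  ΣSub-+ zero    F H = refl
  ΣSub-+ (suc m) F H = trans (+-cong (ΣSub-+ m _ _) (ΣSub-+ m _ _))
                             (solve 4 (λ a b c d → ((a ⊕ b) ⊕ (c ⊕ d)) ⊜ ((a ⊕ c) ⊕ (b ⊕ d))) refl _ _ _ _)

  ΣSub-* : ∀ m a (F : Subset m → Carrier) → ΣSub m (λ s → a * F s) ≈ a * ΣSub m F
  ΣSub-* zero    a F = refl
  ΣSub-* (suc m) a F = trans (+-cong (ΣSub-* m a _) (ΣSub-* m a _)) (sym (distribˡ a _ _))

  Σ⊆ : ∀ {m} → Subset m → (Subset m → Carrier) → Carrier
  Σ⊆ []          F = F []
  Σ⊆ (false ∷ s) F = Σ⊆ s (λ t → F (false ∷ t))
  Σ⊆ (true ∷ s)  F = Σ⊆ s (λ t → F (false ∷ t)) + Σ⊆ s (λ t → F (true ∷ t))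

  Σ⊆-cong : ∀ {m} (s : Subset m) {F H : Subset m → Carrier} → (∀ t → F t ≈ H t) → Σ⊆ s F ≈ Σ⊆ s H
  Σ⊆-cong []          eq = eq []
  Σ⊆-cong (false ∷ s) eq = Σ⊆-cong s (λ t → eq _)
  Σ⊆-cong (true ∷ s)  eq = +-cong (Σ⊆-cong s (λ t → eq _)) (Σ⊆-cong s (λ t → eq _))

  edgeWeight : ∀ m → (Fin m → Carrier) → Subset m → Carrier
  edgeWeight m β t = ∏ m (λ e → if lookup t e then β e else 1#)

  bernoulliWeight : ∀ m → (Fin m → Carrier) → Subset m → Carrier
  bernoulliWeight m β s = ∏ m (λ e → if lookup s e then β e else (1# - β e))

  ΣSub-Σ⊆ : ∀ m β (F : Subset m → Carrier) →
            ΣSub m (λ s → Σ⊆ s F * bernoulliWeight m β s) ≈ ΣSub m (λ t → edgeWeight m β t * F t)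
  ΣSub-Σ⊆ zero    β F = *-comm _ _
  ΣSub-Σ⊆ (suc m) β F = begin
    ΣSub m (λ s → Σ⊆ s F₀ * ((1# - b) * w s)) + ΣSub m (λ s → (Σ⊆ s F₀ + Σ⊆ s F₁) * (b * w s))
      ≈⟨ sym (ΣSub-+ m _ _) ⟩
    ΣSub m (λ s → Σ⊆ s F₀ * ((1# - b) * w s) + (Σ⊆ s F₀ + Σ⊆ s F₁) * (b * w s))
      ≈⟨ ΣSub-cong m (λ s → split-1 (Σ⊆ s F₀) (Σ⊆ s F₁) (w s)) ⟩
    ΣSub m (λ s → Σ⊆ s F₀ * w s + b * (Σ⊆ s F₁ * w s))
      ≈⟨ trans (ΣSub-+ m _ _) (+-cong refl (ΣSub-* m b _)) ⟩
    ΣSub m (λ s → Σ⊆ s F₀ * w s) + b * ΣSub m (λ s → Σ⊆ s F₁ * w s)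
      ≈⟨ +-cong (ΣSub-Σ⊆ m β′ F₀) (*-cong refl (ΣSub-Σ⊆ m β′ F₁)) ⟩
    ΣSub m (λ t → W t * F₀ t) + b * ΣSub m (λ t → W t * F₁ t)
      ≈⟨ +-cong (ΣSub-cong m (λ t → *-cong (sym (*-identityˡ _)) refl))
                (trans (sym (ΣSub-* m b _)) (ΣSub-cong m (λ t → sym (*-assoc b _ _)))) ⟩
    ΣSub m (λ t → (1# * W t) * F₀ t) + ΣSub m (λ t → (b * W t) * F₁ t) ∎
    where
      b  = β Fin.zero
      β′ = λ e → β (Fin.suc e)
      w  = bernoulliWeight m β′
      W  = edgeWeight m β′
      F₀ = λ t → F (false ∷ t)
      F₁ = λ t → F (true ∷ t)
      1-b+b : (1# - b) + b ≈ 1#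
      1-b+b = trans (+-assoc 1# (- b) b) (trans (+-cong refl (-‿inverseˡ b)) (+-identityʳ 1#))
      split-1 : ∀ S₀ S₁ x → S₀ * ((1# - b) * x) + (S₀ + S₁) * (b * x) ≈ S₀ * x + b * (S₁ * x)
      split-1 S₀ S₁ x = begin
        S₀ * ((1# - b) * x) + (S₀ + S₁) * (b * x)
          ≈⟨ solve 5 (λ c b S₀ S₁ x → (S₀ ⊗ (c ⊗ x) ⊕ (S₀ ⊕ S₁) ⊗ (b ⊗ x))
                                    ⊜ (S₀ ⊗ ((c ⊕ b) ⊗ x) ⊕ b ⊗ (S₁ ⊗ x)))
                     refl (1# - b) b S₀ S₁ x ⟩
        S₀ * (((1# - b) + b) * x) + b * (S₁ * x)
          ≈⟨ +-cong (*-cong refl (*-cong 1-b+b refl)) refl ⟩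
        S₀ * (1# * x) + b * (S₁ * x)
          ≈⟨ +-cong (*-cong refl (*-identityˡ x)) refl ⟩
        S₀ * x + b * (S₁ * x) ∎

  module Bouquet (γ : Carrier) where
    -- bouquetPoly k A = ψ_k(A) = Σ_j (k choose j) f_{A+2j}(γ).
    bouquetPoly : ℕ → ℕ → Carrier
    bouquetPoly zero    A = f A γ
    bouquetPoly (suc k) A = bouquetPoly k A + bouquetPoly k (suc (suc A))

    private
      bouquetPoly-+ˡ : ∀ k A₁ A₂ → bouquetPoly 0 A₁ * bouquetPoly k A₂ + bouquetPoly 0 (suc A₁) * bouquetPoly k (suc A₂)
                                    ≈ bouquetPoly k (A₁ ℕ.+ A₂)
      bouquetPoly-+ˡ zero    A₁ A₂ = f-+ γ A₁ A₂
      bouquetPoly-+ˡ (suc k) A₁ A₂ = begin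
        P₀ A₁ * (P A₂ + P (2+ A₂)) + P₀ (suc A₁) * (P (suc A₂) + P (2+ (suc A₂)))
          ≈⟨ solve 6 (λ x y z u w v → (x ⊗ (y ⊕ z) ⊕ u ⊗ (w ⊕ v)) ⊜ ((x ⊗ y ⊕ u ⊗ w) ⊕ (x ⊗ z ⊕ u ⊗ v)))
                     refl _ _ _ _ _ _ ⟩
        (P₀ A₁ * P A₂ + P₀ (suc A₁) * P (suc A₂)) + (P₀ A₁ * P (2+ A₂) + P₀ (suc A₁) * P (suc (2+ A₂)))
          ≈⟨ +-cong (bouquetPoly-+ˡ k A₁ A₂) (bouquetPoly-+ˡ k A₁ (2+ A₂)) ⟩
        P (A₁ ℕ.+ A₂) + P (A₁ ℕ.+ 2+ A₂)
          ≡⟨ ≡.cong (λ B → P (A₁ ℕ.+ A₂) + P B) (≡.trans (ℕ.+-suc A₁ (suc A₂)) (≡.cong suc (ℕ.+-suc A₁ A₂)))  ⟩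
        P (A₁ ℕ.+ A₂) + P (2+ (A₁ ℕ.+ A₂)) ∎
        where
          P₀ = bouquetPoly 0
          P  = bouquetPoly k
          2+ : ℕ → ℕ
          2+ A = suc (suc A)

    bouquetPoly-+ : ∀ k₁ k₂ A₁ A₂ →
      bouquetPoly k₁ A₁ * bouquetPoly k₂ A₂ + bouquetPoly k₁ (suc A₁) * bouquetPoly k₂ (suc A₂)
        ≈ bouquetPoly (k₁ ℕ.+ k₂) (A₁ ℕ.+ A₂)
    bouquetPoly-+ zero     k₂ A₁ A₂ = bouquetPoly-+ˡ k₂ A₁ A₂
    bouquetPoly-+ (suc k₁) k₂ A₁ A₂ = begin
      (P A₁ + P (2+ A₁)) * Q A₂ + (P (suc A₁) + P (2+ (suc A₁))) * Q (suc A₂)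
        ≈⟨ solve 6 (λ x y z w u v → ((x ⊕ y) ⊗ z ⊕ (u ⊕ v) ⊗ w) ⊜ ((x ⊗ z ⊕ u ⊗ w) ⊕ (y ⊗ z ⊕ v ⊗ w)))
                   refl _ _ _ _ _ _ ⟩
      (P A₁ * Q A₂ + P (suc A₁) * Q (suc A₂)) + (P (2+ A₁) * Q A₂ + P (suc (2+ A₁)) * Q (suc A₂))
        ≈⟨ +-cong (bouquetPoly-+ k₁ k₂ A₁ A₂) (bouquetPoly-+ k₁ k₂ (2+ A₁) A₂) ⟩
      bouquetPoly (k₁ ℕ.+ k₂) (A₁ ℕ.+ A₂) + bouquetPoly (k₁ ℕ.+ k₂) (2+ (A₁ ℕ.+ A₂)) ∎
      where
        P = bouquetPoly k₁
        Q = bouquetPoly k₂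
        2+ : ℕ → ℕ
        2+ A = suc (suc A)

    private
      bouquetPoly-degree : ∀ k A → ΣSub k (λ s → f (A ℕ.+ degree (bouquet k) s Fin.zero) γ) ≈ bouquetPoly k A
      bouquetPoly-degree zero    A = reflexive (≡.cong (λ d → f d γ) (ℕ.+-identityʳ A))
      bouquetPoly-degree (suc k) A = +-cong (bouquetPoly-degree k A)
        (trans (ΣSub-cong k (λ s → reflexive (≡.cong (λ d → f d γ) (two-more s)))) (bouquetPoly-degree k (suc (suc A))))
        where
          two-more : ∀ s → A ℕ.+ (2 ℕ.+ degree (bouquet k) s Fin.zero) ≡ suc (suc A) ℕ.+ degree (bouquet k) s Fin.zero
          two-more s = ≡.trans (≡.sym (ℕ.+-assoc A 2 _)) (≡.cong (ℕ._+ degree (bouquet k) s Fin.zero) (ℕ.+-comm A 2))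

    θ-bouquet : ∀ k → θ (bouquet k) 1# γ ≈ bouquetPoly k 0
    θ-bouquet k = trans (ΣSub-cong k (λ s → trans (*-cong (∏-1 k (λ e → one (lookup s e))) (*-identityʳ _)) (*-identityˡ _)))
                        (bouquetPoly-degree k 0)
      where
        one : ∀ b → (if b then 1# else 1#) ≈ 1#
        one true  = refl
        one false = refl

  pick-two : ∀ {n} {χ : Fin n → Bool} {r₁ r₂} v → r₁ ≢ r₂ → χ r₁ ≡ true → χ r₂ ≡ true →
             Least χ r₁ ⊎ Least χ r₂ → (if noneBelow r₁ χ then v else 1#) * (if noneBelow r₂ χ then v else 1#) ≈ v
  pick-two v r₁≢r₂ χr₁ χr₂ (inj₁ least)
    rewrite noneBelow-least least | noneBelow-not-least least χr₂ (r₁≢r₂ ∘ ≡.sym) = *-identityʳ v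
  pick-two v r₁≢r₂ χr₁ χr₂ (inj₂ least)
    rewrite noneBelow-least least | noneBelow-not-least least χr₁ r₁≢r₂ = *-identityˡ v

  -- Factorisation over components

  module Factorisation (γ : Carrier) where
    open Bouquet γ

    componentFactor : ∀ {n m} → (Fin m → Fin n × Fin n) → Subset m → (Fin n → ℕ) → Fin n → (Fin n → Bool) → Carrier
    componentFactor en s a i χ = if noneBelow i χ then bouquetPoly (nullityOf en s χ) (offset a χ) else 1#

    componentProduct : ∀ {n m} → (Fin m → Fin n × Fin n) → Subset m → (Fin n → ℕ) → Carrier
    componentProduct {n} en s a = ∏ n (λ i → componentFactor en s a i (component (graphOf en) s i))

    module _ {n m} (en : Fin m → Fin n × Fin n) (s : Subset m) (a : Fin n → ℕ) (i : Fin n) where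
      componentFactor-cong : ∀ {χ ψ} → χ ≐ ψ → componentFactor en s a i χ ≡ componentFactor en s a i ψ
      componentFactor-cong {χ} {ψ} χ≐ψ
        rewrite noneBelow-cong i χ≐ψ | nullityOf-cong en s χ≐ψ | offset-cong a χ≐ψ = ≡.refl

      componentFactor-least : ∀ {χ} → noneBelow i χ ≡ true →
                              componentFactor en s a i χ ≡ bouquetPoly (nullityOf en s χ) (offset a χ)
      componentFactor-least below rewrite below = ≡.refl

      componentFactor-other : ∀ {χ} → noneBelow i χ ≡ false → componentFactor en s a i χ ≡ 1#
      componentFactor-other below rewrite below = ≡.refl

    module EdgeStep {n m} (en : Fin (suc m) → Fin n × Fin n) (s : Subset m) (a : Fin n → ℕ) where
      open AddEdge en s

      a′ : Fin n → ℕ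
      a′ j = a j ℕ.+ (b2n (p₀ == j) ℕ.+ b2n (q₀ == j))

      X Y Z : Fin n → Carrier
      X i = componentFactor en (true ∷ s) a i (c i)
      Y i = componentFactor en′ s a i (c′ i)
      Z i = componentFactor en′ s a′ i (c′ i)

      Agree : Fin n → Set ℓ
      Agree i = X i ≈ Y i × X i ≈ Z i

      untouched-agree : ∀ i → c′ i p₀ ≡ false → c′ i q₀ ≡ false → Agree i
      untouched-agree i i≁p₀ i≁q₀ = reflexive X≡Y , reflexive (≡.trans X≡Y (≡.sym Z≡Y))
        where
          X≡Y : X i ≡ Y i
          X≡Y rewrite componentFactor-cong en (true ∷ s) a i (untouched-class i i≁p₀ i≁q₀) | i≁p₀ = ≡.refl
          Z≡Y : Z i ≡ Y i
          Z≡Y rewrite offset-shift a p₀ q₀ (c′ i) | i≁p₀ | i≁q₀ | ℕ.+-identityʳ (offset a (c′ i)) = ≡.refl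

      other-agree : ∀ i → noneBelow i (c i) ≡ false → noneBelow i (c′ i) ≡ false → Agree i
      other-agree i new old = reflexive (≡.trans X≡1 (≡.sym (componentFactor-other en′ s a i old)))
                            , reflexive (≡.trans X≡1 (≡.sym (componentFactor-other en′ s a′ i old)))
        where X≡1 = componentFactor-other en (true ∷ s) a i new

      below-in-class : ∀ {x r} i → Least (c′ x) r → c′ i x ≡ true → i ≢ r → noneBelow i (c′ i) ≡ false
      below-in-class {x} i least i~x i≢r =
        ≡.trans (noneBelow-cong i (component-class i x i~x))
                (noneBelow-not-least least (≡.trans (component-sym x i) i~x) i≢r)

      module _ {x r} (least : Least (c′ x) r) where
        private
          r~x : c′ r x ≡ true
          r~x = ≡.trans (component-sym r x) (proj₁ least)

        Y-least : Y r ≡ bouquetPoly (nullityOf en′ s (c′ x)) (offset a (c′ x))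
        Y-least = ≡.trans (componentFactor-cong en′ s a r (component-class r x r~x))
                          (componentFactor-least en′ s a r (noneBelow-least least))

        Z-least : Z r ≡ bouquetPoly (nullityOf en′ s (c′ x)) (offset a (c′ x) ℕ.+ (b2n (c′ x p₀) ℕ.+ b2n (c′ x q₀)))
        Z-least = ≡.trans (componentFactor-cong en′ s a′ r (component-class r x r~x))
                  (≡.trans (componentFactor-least en′ s a′ r (noneBelow-least least))
                           (≡.cong (bouquetPoly (nullityOf en′ s (c′ x))) (offset-shift a p₀ q₀ (c′ x))))

      module Cycle (p₀~q₀ : c′ p₀ q₀ ≡ true) {r} (least : Least (c′ p₀) r) where
        private
          q₀-like-p₀ : ∀ i → c′ i q₀ ≡ c′ i p₀
          q₀-like-p₀ i = ≡.trans (component-sym i q₀)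
                         (≡.trans (≡.sym (component-class p₀ q₀ p₀~q₀ i)) (component-sym p₀ i))

          off-r : ∀ i → i ≢ r → Agree i
          off-r i i≢r with c′ i p₀ in i~p₀
          ... | true  = other-agree i (≡.trans (noneBelow-cong i (cycle-class p₀~q₀ i)) old) old
            where old = below-in-class i least i~p₀ i≢r
          ... | false = untouched-agree i i~p₀ (≡.trans (q₀-like-p₀ i) i~p₀)

          N = nullityOf en′ s (c′ p₀)
          A = offset a (c′ p₀)

          X-least : X r ≈ bouquetPoly (suc N) A
          X-least = begin
            X r
              ≡⟨ componentFactor-cong en (true ∷ s) a r (λ w →
                   ≡.trans (cycle-class p₀~q₀ r w) (component-class r p₀ r~p₀ w)) ⟩
            componentFactor en (true ∷ s) a r (c′ p₀)
              ≡⟨ componentFactor-least en (true ∷ s) a r (noneBelow-least least) ⟩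
            bouquetPoly (nullityOf en (true ∷ s) (c′ p₀)) A
              ≡⟨ ≡.cong (λ k → bouquetPoly k A) nullity-suc ⟩
            bouquetPoly (suc N) A ∎
            where
              r~p₀ = ≡.trans (component-sym r p₀) (proj₁ least)
              nullity-suc : nullityOf en (true ∷ s) (c′ p₀) ≡ suc N
              nullity-suc rewrite component-refl p₀ | p₀~q₀ =
                ℕ.+-∸-assoc 1 (component-size-bound en′ s p₀)

        result : ∏ n X ≈ ∏ n Y + ∏ n Z
        result = ∏-split-at n X Y Z r off-r (begin
          X r                                   ≈⟨ X-least ⟩
          bouquetPoly N A + bouquetPoly N (suc (suc A))
                                                ≡⟨ ≡.cong₂ _+_ (≡.sym (Y-least least)) (≡.sym Z-r) ⟩
          Y r + Z r                             ∎)
          where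
            Z-r : Z r ≡ bouquetPoly N (suc (suc A))
            Z-r rewrite Z-least least | component-refl p₀ | p₀~q₀ | ℕ.+-comm A 2 = ≡.refl

      module BridgeStep (p₀≁q₀ : c′ p₀ q₀ ≡ false) {r₁ r₂} (least₁ : Least (c′ p₀) r₁)
                        (least₂ : Least (c′ q₀) r₂) where
        open Bridge p₀≁q₀

        private
          r₁~p₀ : c′ r₁ p₀ ≡ true
          r₁~p₀ = ≡.trans (component-sym r₁ p₀) (proj₁ least₁)

          r₂~q₀ : c′ r₂ q₀ ≡ true
          r₂~q₀ = ≡.trans (component-sym r₂ q₀) (proj₁ least₂)

          r₁≢r₂ : r₁ ≢ r₂
          r₁≢r₂ r₁≡r₂ = true≢false (≡.trans (≡.sym (component-trans p₀ r₁ q₀ (proj₁ least₁)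
                                               (≡.subst (λ r → c′ r q₀ ≡ true) (≡.sym r₁≡r₂) r₂~q₀))) p₀≁q₀)

          r₁∈merged : merged r₁ ≡ true
          r₁∈merged = ≡.cong (_∨ c′ q₀ r₁) (proj₁ least₁)

          r₂∈merged : merged r₂ ≡ true
          r₂∈merged = ≡.trans (≡.cong (c′ p₀ r₂ ∨_) (proj₁ least₂)) (∨-zeroʳ _)

          merged-below : ∀ {x r} i → (c′ i p₀ ∨ c′ i q₀) ≡ true → Least (c′ x) r → merged r ≡ true →
                         c′ i x ≡ true → i ≢ r → noneBelow i (c i) ≡ false
          merged-below {x} i touched least r∈ i~x i≢r =
            ≡.trans (noneBelow-cong i (merged-class i touched))
                    (noneBelow-false r∈ (least-below least (≡.trans (component-sym x i) i~x) i≢r))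

          off-r : ∀ i → i ≢ r₁ → i ≢ r₂ → Agree i
          off-r i i≢r₁ i≢r₂ with c′ i p₀ in i~p₀ | c′ i q₀ in i~q₀
          ... | true  | _     = other-agree i (merged-below i (≡.cong (_∨ c′ i q₀) i~p₀) least₁ r₁∈merged i~p₀ i≢r₁)
                                              (below-in-class i least₁ i~p₀ i≢r₁)
          ... | false | true  = other-agree i (merged-below i (≡.trans (≡.cong (_∨ c′ i q₀) i~p₀) i~q₀)
                                                             least₂ r₂∈merged i~q₀ i≢r₂)
                                              (below-in-class i least₂ i~q₀ i≢r₂)
          ... | false | false = untouched-agree i i~p₀ i~q₀

          N₁ = nullityOf en′ s (c′ p₀)
          N₂ = nullityOf en′ s (c′ q₀)
          A₁ = offset a (c′ p₀)
          A₂ = offset a (c′ q₀)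

          merged-nullity : nullityOf en (true ∷ s) merged ≡ N₁ ℕ.+ N₂
          merged-nullity = ≡.trans (≡.cong₂ (λ E V → (E ℕ.+ 1) ∸ V) merged-edgeCount (size-∪ disjoint))
            (nullity-∪ _ _ _ _ (component-size-bound en′ s p₀) (component-size-bound en′ s q₀))

          X-pair : X r₁ * X r₂ ≈ bouquetPoly (N₁ ℕ.+ N₂) (A₁ ℕ.+ A₂)
          X-pair = begin
            X r₁ * X r₂
              ≡⟨ ≡.cong₂ _*_ (componentFactor-cong en (true ∷ s) a r₁ (merged-class r₁ (≡.cong (_∨ c′ r₁ q₀) r₁~p₀)))
                             (componentFactor-cong en (true ∷ s) a r₂ (merged-class r₂
                               (≡.trans (≡.cong (c′ r₂ p₀ ∨_) r₂~q₀) (∨-zeroʳ _)))) ⟩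
            componentFactor en (true ∷ s) a r₁ merged * componentFactor en (true ∷ s) a r₂ merged
              ≈⟨ pick-two _ r₁≢r₂ r₁∈merged r₂∈merged (least-∪ least₁ least₂) ⟩
            bouquetPoly (nullityOf en (true ∷ s) merged) (offset a merged)
              ≡⟨ ≡.cong₂ bouquetPoly merged-nullity (offset-∪ a disjoint) ⟩
            bouquetPoly (N₁ ℕ.+ N₂) (A₁ ℕ.+ A₂) ∎

          Z-r₁ : Z r₁ ≡ bouquetPoly N₁ (suc A₁)
          Z-r₁ rewrite Z-least least₁ | component-refl p₀ | p₀≁q₀ | ℕ.+-comm A₁ 1 = ≡.refl

          Z-r₂ : Z r₂ ≡ bouquetPoly N₂ (suc A₂)
          Z-r₂ rewrite Z-least least₂ | component-refl q₀ | component-sym q₀ p₀ | p₀≁q₀ | ℕ.+-comm A₂ 1 = ≡.refl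

        result : ∏ n X ≈ ∏ n Y + ∏ n Z
        result = ∏-split-at₂ n X Y Z r₁≢r₂ off-r (begin
          X r₁ * X r₂                                   ≈⟨ X-pair ⟩
          bouquetPoly (N₁ ℕ.+ N₂) (A₁ ℕ.+ A₂)           ≈⟨ sym (bouquetPoly-+ N₁ N₂ A₁ A₂) ⟩
          bouquetPoly N₁ A₁ * bouquetPoly N₂ A₂ + bouquetPoly N₁ (suc A₁) * bouquetPoly N₂ (suc A₂)
            ≡⟨ ≡.cong₂ _+_ (≡.cong₂ _*_ (≡.sym (Y-least least₁)) (≡.sym (Y-least least₂)))
                           (≡.cong₂ _*_ (≡.sym Z-r₁) (≡.sym Z-r₂)) ⟩
          Y r₁ * Y r₂ + Z r₁ * Z r₂                     ∎)

      edge-step : componentProduct en (true ∷ s) a ≈ componentProduct en′ s a + componentProduct en′ s a′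
      edge-step with c′ p₀ q₀ in p₀~q₀
      ... | true  = Cycle.result p₀~q₀ (proj₂ (least-exists (c′ p₀) p₀ (component-refl p₀)))
      ... | false = BridgeStep.result p₀~q₀ (proj₂ (least-exists (c′ p₀) p₀ (component-refl p₀)))
                                          (proj₂ (least-exists (c′ q₀) q₀ (component-refl q₀)))

    degreeSum : ∀ {n m} → (Fin m → Fin n × Fin n) → Subset m → (Fin n → ℕ) → Carrier
    degreeSum {n} en s a = Σ⊆ s (λ t → ∏ n (λ i → f (a i ℕ.+ degree (graphOf en) t i) γ))

    degreeSum-factorises : ∀ {n m} (en : Fin m → Fin n × Fin n) s a → degreeSum en s a ≈ componentProduct en s a
    degreeSum-factorises {n} {zero} en [] a = ∏-cong n isolated
      where
        isolated : ∀ i → f (a i ℕ.+ 0) γ ≈ componentFactor en [] a i (component (graphOf en) [] i)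
        isolated i rewrite componentFactor-cong en [] a i (component-empty en i)
                         | noneBelow-least (least-singleton i)
                         | count-singleton n i | sumℕ-at n i a | ℕ.+-identityʳ (a i) = refl
    degreeSum-factorises {n} {suc m} en (false ∷ s) a =
      trans (degreeSum-factorises en′ s a)
            (∏-cong n (λ i → reflexive (≡.sym (componentFactor-cong en′ s a i (component-outside s i)))))
      where open FirstEdge en
    degreeSum-factorises {n} {suc m} en (true ∷ s) a = begin
      degreeSum en′ s a + Σ⊆ s (λ t → ∏ n (λ i → f (a i ℕ.+ (b2n (p₀ == i) ℕ.+ b2n (q₀ == i) ℕ.+ deg′ t i)) γ))
        ≈⟨ +-cong refl (Σ⊆-cong s (λ t → ∏-cong n (λ i → reflexive (≡.cong (λ d → f d γ) (≡.sym (ℕ.+-assoc (a i) _ _)))))) ⟩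
      degreeSum en′ s a + degreeSum en′ s a′
        ≈⟨ +-cong (degreeSum-factorises en′ s a) (degreeSum-factorises en′ s a′) ⟩
      componentProduct en′ s a + componentProduct en′ s a′
        ≈⟨ sym edge-step ⟩
      componentProduct en (true ∷ s) a ∎
      where
        open FirstEdge en
        open EdgeStep en s a
        deg′ = degree (graphOf en′)

    bouquetFactor-components : ∀ G s → bouquetFactor G γ s ≈ componentProduct (ends G) s (λ _ → 0)
    bouquetFactor-components G s = begin
      ∏ (suc m) (λ k → pow (θ (bouquet (toℕ k)) 1# γ) (numComp G s (toℕ k)))
        ≈⟨ ∏-cong (suc m) (λ k → pow-cong (numComp G s (toℕ k)) (θ-bouquet (toℕ k))) ⟩
      ∏ (suc m) (λ k → pow (bouquetPoly (toℕ k) 0) (numComp G s (toℕ k)))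
        ≈⟨ ∏-cong (suc m) (λ k → pow-count n (bouquetPoly (toℕ k) 0) (λ i → isRep G s i ∧ (nullity G s i ≡ᵇ toℕ k))) ⟩
      ∏ (suc m) (λ k → ∏ n (λ i → if isRep G s i ∧ (nullity G s i ≡ᵇ toℕ k) then bouquetPoly (toℕ k) 0 else 1#))
        ≈⟨ ∏-comm (suc m) n (λ k i → if isRep G s i ∧ (nullity G s i ≡ᵇ toℕ k) then bouquetPoly (toℕ k) 0 else 1#) ⟩
      ∏ n (λ i → ∏ (suc m) (λ k → if isRep G s i ∧ (nullity G s i ≡ᵇ toℕ k) then bouquetPoly (toℕ k) 0 else 1#))
        ≈⟨ ∏-cong n vertex ⟩
      componentProduct (ends G) s (λ _ → 0) ∎
      where
        n = nV G
        m = nE G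
        vertex : ∀ i → ∏ (suc m) (λ k → if isRep G s i ∧ (nullity G s i ≡ᵇ toℕ k) then bouquetPoly (toℕ k) 0 else 1#)
                       ≈ componentFactor (ends G) s (λ _ → 0) i (component G s i)
        vertex i with isRep G s i
        ... | false = ∏-1 (suc m) (λ _ → refl)
        ... | true rewrite offset-zero (component G s i) =
          ∏-at (suc m) (λ k → bouquetPoly k 0) (s≤s (nullity-≤-edges (ends G) s i))

theorem7p3 : ∀ {c ℓ : Level} (R : CommutativeRing c ℓ) →
    let open CommutativeRing R
        open WithRing R
    in (G : Multigraph) (β : Fin (nE G) → Carrier) (γ : Carrier) →
       Θ G β (λ _ → γ) ≈
         ΣSub (nE G) (λ s →
           bouquetFactor G γ s
             * ∏ (nE G) (λ e → if e ∈ᵇ s then β e else (1# - β e)))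
theorem7p3 R G β γ = begin
  Θ G β (λ _ → γ)
    ≈⟨ sym (ΣSub-Σ⊆ (nE G) β (λ t → ∏ (nV G) (λ i → f (degree G t i) γ))) ⟩
  ΣSub (nE G) (λ s → degreeSum (ends G) s (λ _ → 0) * bernoulliWeight (nE G) β s)
    ≈⟨ ΣSub-cong (nE G) (λ s → *-cong (degreeSum-factorises (ends G) s (λ _ → 0)) refl) ⟩
  ΣSub (nE G) (λ s → componentProduct (ends G) s (λ _ → 0) * bernoulliWeight (nE G) β s)
    ≈⟨ ΣSub-cong (nE G) (λ s → *-cong (sym (bouquetFactor-components G s)) refl) ⟩
  ΣSub (nE G) (λ s → bouquetFactor G γ s * bernoulliWeight (nE G) β s) ∎
  where
    open CommutativeRing R
    open WithRing R
    open WithCommutativeRing R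
    open Factorisation γ
    open SetoidReasoning setoid
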